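{- Let $F$ be a filter in the Ignatiev algebra $\mathfrak{I}$. For $i\in\omega$ let $F_i:=\{\alpha_i:\vec\alpha\in F\}$. Then for every $i\in\omega$: (i) $F_i$ is nonempty; (ii) if $\alpha\in F_i$ and $\beta<\alpha$, then $\beta\in F_i$; (iii) if $\alpha\in F_i$, $\beta\in F_{i+1}$ and $\ell(\alpha)<\beta$, then $\alpha+\omega^\beta\in F_i$.
   Context: Ordinal conventions: $\varepsilon_0$ is the least ordinal $\varepsilon$ with $\omega^\varepsilon=\varepsilon$. For an ordinal $\alpha>0$, $\ell(\alpha)$ is the unique $\beta$ such that $\alpha=\gamma+\omega^\beta$ for some $\gamma$; this is the last exponent in the Cantor normal form. Also $\ell(0)=0$. Ignatiev sequences: $I$ is the set of sequences $\vec\alpha=(\alpha_i)_{i\in\omega}$ of ordinals $<\varepsilon_0$ with $\alpha_{i+1}\le\ell(\alpha_i)$ for all $i$. Such sequences are eventually $0$. Ignatiev algebra $\mathfrak{I}$: its universe is $I$. The order is $\vec\alpha\le_\mathfrak{I}\vec\beta$ iff $\alpha_i\ge\beta_i$ for all $i$. The meet $\vec\alpha\land_\mathfrak{I}\vec\beta$ is the $\le_\mathfrak{I}$-greatest lower bound. Explicitly, put $\gamma_i=\max(\alpha_i,\beta_i)$ and take $N$ with $\gamma_i=0$ for $i\ge N$. Then $\vec\delta=\vec\alpha\land_\mathfrak{I}\vec\beta$ has $\delta_i=0$ for $i\ge N$, and downward for $i<N$: $\delta_i=\gamma_i$ if $\ell(\gamma_i)\ge\delta_{i+1}$, and $\delta_i=\gamma_i+\omega^{\delta_{i+1}}$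 otherwise. Filters: a filter in $\mathfrak{I}$ is a nonempty $F\subseteq I$ that is upward closed under $\le_\mathfrak{I}$ and closed under $\land_\mathfrak{I}$. -}

module Defs where

open import Data.Nat using (ℕ; suc)
open import Data.Product using (Σ; ∃; _×_; _,_)
open import Data.Sum using (_⊎_)
open import Relation.Nullary using (Dec; yes; no; ¬_)
open import Relation.Binary.PropositionalEquality using (_≡_; refl)

-- Ordinals below ε₀ in Cantor normal form.
-- A raw term is 𝟎 or  ω^ a ⊕ b  (meaning ω^a + b).
-- Normal-form terms (IsNF) correspond bijectively to the ordinals < ε₀,
-- so syntactic equality of NF terms is ordinal equality.

infixr 6 ω^_⊕_

data Tm : Set where
  𝟎     : Tm
  ω^_⊕_ : Tm → Tm → Tm

infix 4 _<_ _≤_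

data _<_ : Tm → Tm → Set where
  z<ω  : ∀ {a b} → 𝟎 < ω^ a ⊕ b
  lex₁ : ∀ {a b c d} → a < c → ω^ a ⊕ b < ω^ c ⊕ d
  lex₂ : ∀ {a b c d} → a ≡ c → b < d → ω^ a ⊕ b < ω^ c ⊕ d

_≤_ : Tm → Tm → Set
a ≤ b = a < b ⊎ a ≡ b

data IsNF : Tm → Set where
  nf𝟎 : IsNF 𝟎
  nfω : ∀ {a} → IsNF a → IsNF (ω^ a ⊕ 𝟎)
  nf⊕ : ∀ {a c d} → IsNF a → IsNF (ω^ c ⊕ d) → c ≤ a → IsNF (ω^ a ⊕ ω^ c ⊕ d)

ω-inj₁ : ∀ {a b c d} → ω^ a ⊕ b ≡ ω^ c ⊕ d → a ≡ c
ω-inj₁ refl = refl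

ω-inj₂ : ∀ {a b c d} → ω^ a ⊕ b ≡ ω^ c ⊕ d → b ≡ d
ω-inj₂ refl = refl

_≟_ : (a b : Tm) → Dec (a ≡ b)
𝟎 ≟ 𝟎 = yes refl
𝟎 ≟ (ω^ _ ⊕ _) = no (λ ())
(ω^ _ ⊕ _) ≟ 𝟎 = no (λ ())
(ω^ a ⊕ b) ≟ (ω^ c ⊕ d) with a ≟ c | b ≟ d
... | yes refl | yes refl = yes refl
... | no ne | _ = no (λ e → ne (ω-inj₁ e))
... | yes _ | no ne = no (λ e → ne (ω-inj₂ e))

_<?_ : (a b : Tm) → Dec (a < b)
𝟎 <? 𝟎 = no (λ ())
𝟎 <? (ω^ _ ⊕ _) = yes z<ω
(ω^ _ ⊕ _) <? 𝟎 = no (λ ())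
(ω^ a ⊕ b) <? (ω^ c ⊕ d) with a <? c
... | yes p = yes (lex₁ p)
... | no ¬p with a ≟ c
...   | no ne = no λ { (lex₁ p) → ¬p p ; (lex₂ e _) → ne e }
...   | yes e with b <? d
...     | yes q = yes (lex₂ e q)
...     | no ¬q = no λ { (lex₁ p) → ¬p p ; (lex₂ _ q) → ¬q q }

ℓ : Tm → Tm
ℓ 𝟎 = 𝟎
ℓ (ω^ a ⊕ 𝟎) = a
ℓ (ω^ a ⊕ (ω^ c ⊕ d)) = ℓ (ω^ c ⊕ d)

_+ω^_ : Tm → Tm → Tm
𝟎 +ω^ β = ω^ β ⊕ 𝟎
(ω^ a ⊕ b) +ω^ β with a <? β
... | yes _ = ω^ β ⊕ 𝟎
... | no _  = ω^ a ⊕ (b +ω^ β)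

record ISeq : Set where
  field
    seq  : ℕ → Tm
    nf   : ∀ i → IsNF (seq i)
    cond : ∀ i → seq (suc i) ≤ ℓ (seq i)
open ISeq public

_≤I_ : ISeq → ISeq → Set
s ≤I t = ∀ i → seq t i ≤ seq s i

IsMeet : ISeq → ISeq → ISeq → Set
IsMeet m s t = (m ≤I s × m ≤I t) × (∀ u → u ≤I s → u ≤I t → u ≤I m)

record IsFilter (F : ISeq → Set) : Set where
  field
    nonempty  : ∃ λ s → F s
    upward    : ∀ {s t} → F s → s ≤I t → F t
    meetClosed : ∀ {s t m} → F s → F t → IsMeet m s t → F m

Proj : (ISeq → Set) → ℕ → Tm → Set
Proj F i α = ∃ λ s → F s × seq s i ≡ α

module Submission where

-- For (ii) and (iii) the key tool
-- is LOWERING: replacing the i-th entry of s ∈ F by some β ≤ sᵢ and all later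
-- entries by 0 yields an Ignatiev sequence above s in ≤_I, hence again in F.
-- Lowering proves (ii) directly (in the stronger form β ≤ α), and with β = sᵢ
-- it TRUNCATES sequences to finite support.
-- For (iii) take s, t ∈ F with sᵢ = α, tᵢ₊₁ = β and truncate them after i and
-- i+1.  Sequences of finite support have a meet: the least Ignatiev sequence
-- above their pointwise maximum, computed downwards by δⱼ = raise γⱼ δⱼ₊₁,
-- where raise g b is the least ordinal ≥ g whose last exponent is ≥ b.  The
-- meet m lies in F, and mᵢ ≥ α with β ≤ mᵢ₊₁ ≤ ℓ(mᵢ); since α + ω^β is the
-- least ordinal ≥ α whose last exponent is ≥ β (when ℓ(α) < β), this gives
-- α + ω^β ≤ mᵢ, and (ii) finishes the proof.

open import Defs
open import Data.Nat using (ℕ; zero; suc; s≤s) renaming (_≤_ to _≤ₙ_; _<_ to _<ₙ_; _+_ to _+ₙ_)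
open import Data.Nat.Properties using (+-identityʳ; +-suc; m≤n+m; n≤1+n)
  renaming (≤-trans to ≤ₙ-trans)
open import Data.Product using (∃; _×_; _,_; proj₁; proj₂)
open import Data.Sum using (_⊎_; inj₁; inj₂)
open import Data.Unit using (⊤)
open import Data.Empty using (⊥-elim)
open import Relation.Nullary using (yes; no; ¬_)
open import Relation.Binary.PropositionalEquality using (_≡_; refl; sym; cong; subst)

<-irrefl : ∀ {a} → ¬ (a < a)
<-irrefl (lex₁ p)   = <-irrefl p
<-irrefl (lex₂ _ q) = <-irrefl q

<-trans : ∀ {a b c} → a < b → b < c → a < c
<-trans z<ω          (lex₁ _)      = z<ω
<-trans z<ω          (lex₂ _ _)    = z<ω
<-trans (lex₁ p)      (lex₁ q)      = lex₁ (<-trans p q)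
<-trans (lex₁ p)      (lex₂ refl _) = lex₁ p
<-trans (lex₂ refl _) (lex₁ q)      = lex₁ q
<-trans (lex₂ refl p) (lex₂ refl q) = lex₂ refl (<-trans p q)

≤-trans : ∀ {a b c} → a ≤ b → b ≤ c → a ≤ c
≤-trans (inj₁ p)    (inj₁ q)    = inj₁ (<-trans p q)
≤-trans (inj₁ p)    (inj₂ refl) = inj₁ p
≤-trans (inj₂ refl) q           = q

≤-<-trans : ∀ {a b c} → a ≤ b → b < c → a < c
≤-<-trans (inj₁ p)    q = <-trans p q
≤-<-trans (inj₂ refl) q = q

<-trichotomy : ∀ a b → a < b ⊎ a ≡ b ⊎ b < a
<-trichotomy 𝟎          𝟎          = inj₂ (inj₁ refl)
<-trichotomy 𝟎          (ω^ _ ⊕ _) = inj₁ z<ω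
<-trichotomy (ω^ _ ⊕ _) 𝟎          = inj₂ (inj₂ z<ω)
<-trichotomy (ω^ a ⊕ b) (ω^ c ⊕ d) with <-trichotomy a c
... | inj₁ p        = inj₁ (lex₁ p)
... | inj₂ (inj₂ p) = inj₂ (inj₂ (lex₁ p))
... | inj₂ (inj₁ refl) with <-trichotomy b d
...   | inj₁ q           = inj₁ (lex₂ refl q)
...   | inj₂ (inj₁ refl) = inj₂ (inj₁ refl)
...   | inj₂ (inj₂ q)    = inj₂ (inj₂ (lex₂ refl q))

≮⇒≥ : ∀ {a b} → ¬ (a < b) → b ≤ a
≮⇒≥ {a} {b} a≮b with <-trichotomy a b
... | inj₁ p           = ⊥-elim (a≮b p)
... | inj₂ (inj₁ refl) = inj₂ refl
... | inj₂ (inj₂ p)    = inj₁ p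

𝟎≤ : ∀ a → 𝟎 ≤ a
𝟎≤ 𝟎          = inj₂ refl
𝟎≤ (ω^ _ ⊕ _) = inj₁ z<ω

-- LeadsBelow c a: the leading exponent of c is at most a (vacuous for c = 0),
-- i.e. ω^a + c is in normal form whenever a and c are.
LeadsBelow : Tm → Tm → Set
LeadsBelow 𝟎          a = ⊤
LeadsBelow (ω^ c ⊕ _) a = c ≤ a

nf-head : ∀ {a c} → IsNF (ω^ a ⊕ c) → IsNF a
nf-head (nfω na)     = na
nf-head (nf⊕ na _ _) = na

nf-tail : ∀ {a c} → IsNF (ω^ a ⊕ c) → IsNF c
nf-tail (nfω _)      = nf𝟎
nf-tail (nf⊕ _ nc _) = nc

nf-leads : ∀ {a c} → IsNF (ω^ a ⊕ c) → LeadsBelow c a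
nf-leads (nfω _)       = _
nf-leads (nf⊕ _ _ c≤a) = c≤a

nf-⊕+ω^ : ∀ {a} c {b} → IsNF a → IsNF c → IsNF b → b ≤ a → LeadsBelow c a →
          IsNF (ω^ a ⊕ (c +ω^ b))
nf-⊕+ω^ 𝟎            na _  nb b≤a _ = nf⊕ na (nfω nb) b≤a
nf-⊕+ω^ (ω^ c₁ ⊕ c₂) {b} na nc nb b≤a c≤a with c₁ <? b
... | yes _    = nf⊕ na (nfω nb) b≤a
... | no c₁≮b  = nf⊕ na (nf-⊕+ω^ c₂ (nf-head nc) (nf-tail nc) nb (≮⇒≥ c₁≮b) (nf-leads nc)) c≤a

nf-+ω^ : ∀ γ {b} → IsNF γ → IsNF b → IsNF (γ +ω^ b)
nf-+ω^ 𝟎          _  nb = nfω nb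
nf-+ω^ (ω^ a ⊕ c) {b} nγ nb with a <? b
... | yes _   = nfω nb
... | no a≮b  = nf-⊕+ω^ c (nf-head nγ) (nf-tail nγ) nb (≮⇒≥ a≮b) (nf-leads nγ)

ℓ-⊕+ω^ : ∀ a c b → ℓ (ω^ a ⊕ (c +ω^ b)) ≡ b
ℓ-⊕+ω^ a 𝟎            b = refl
ℓ-⊕+ω^ a (ω^ c₁ ⊕ c₂) b with c₁ <? b
... | yes _ = refl
... | no _  = ℓ-⊕+ω^ c₁ c₂ b

ℓ-+ω^ : ∀ γ b → ℓ (γ +ω^ b) ≡ b
ℓ-+ω^ 𝟎          b = refl
ℓ-+ω^ (ω^ a ⊕ c) b with a <? b
... | yes _ = refl
... | no _  = ℓ-⊕+ω^ a c b

<-+ω^ : ∀ γ b → γ < γ +ω^ b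
<-+ω^ 𝟎          b = z<ω
<-+ω^ (ω^ a ⊕ c) b with a <? b
... | yes a<b = lex₁ a<b
... | no _    = lex₂ refl (<-+ω^ c b)

ℓ≤head : ∀ {e f} → IsNF (ω^ e ⊕ f) → ℓ (ω^ e ⊕ f) ≤ e
ℓ≤head (nfω _)         = inj₂ refl
ℓ≤head (nf⊕ _ nf c≤e) = ≤-trans (ℓ≤head nf) c≤e

ω^≤ : ∀ e f b → IsNF (ω^ e ⊕ f) → b ≤ ℓ (ω^ e ⊕ f) → ω^ b ⊕ 𝟎 ≤ ω^ e ⊕ f
ω^≤ e f b nv b≤ℓv with ≤-trans b≤ℓv (ℓ≤head nv)
... | inj₁ b<e = inj₁ (lex₁ b<e)
ω^≤ e 𝟎          b nv b≤ℓv | inj₂ refl = inj₂ refl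
ω^≤ e (ω^ _ ⊕ _) b nv b≤ℓv | inj₂ refl = inj₁ (lex₂ refl z<ω)

+ω^-least : ∀ γ v b → IsNF γ → IsNF v → γ ≤ v → b ≤ ℓ v → ℓ γ < b → γ +ω^ b ≤ v
+ω^-least 𝟎 𝟎 b _ _ _ (inj₁ ()) _
+ω^-least 𝟎 𝟎 b _ _ _ (inj₂ refl) ℓγ<b = ⊥-elim (<-irrefl ℓγ<b)
+ω^-least 𝟎 (ω^ e ⊕ f) b _ nv _ b≤ℓv _ = ω^≤ e f b nv b≤ℓv
+ω^-least (ω^ a ⊕ c) 𝟎 b _ _ (inj₁ ()) _ _
+ω^-least (ω^ a ⊕ c) 𝟎 b _ _ (inj₂ ()) _ _
+ω^-least (ω^ a ⊕ c) (ω^ e ⊕ f) b nγ nv γ≤v b≤ℓv ℓγ<b with a <? b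
... | yes _ = ω^≤ e f b nv b≤ℓv
... | no a≮b with γ≤v
...   | inj₂ refl     = ⊥-elim (<-irrefl (≤-<-trans b≤ℓv ℓγ<b))
...   | inj₁ (lex₁ p) = inj₁ (lex₁ p)
+ω^-least (ω^ a ⊕ 𝟎) _ b _ _ _ _ ℓγ<b | no a≮b | inj₁ (lex₂ refl _) = ⊥-elim (a≮b ℓγ<b)
+ω^-least (ω^ a ⊕ (ω^ c₁ ⊕ c₂)) (ω^ e ⊕ 𝟎) b _ _ _ _ _ | no _ | inj₁ (lex₂ refl ())
+ω^-least (ω^ a ⊕ (ω^ c₁ ⊕ c₂)) (ω^ e ⊕ (ω^ f₁ ⊕ f₂)) b nγ nv _ b≤ℓv ℓγ<b
  | no _ | inj₁ (lex₂ refl c<f)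
  with +ω^-least (ω^ c₁ ⊕ c₂) (ω^ f₁ ⊕ f₂) b (nf-tail nγ) (nf-tail nv) (inj₁ c<f) b≤ℓv ℓγ<b
... | inj₁ lt = inj₁ (lex₂ refl lt)
... | inj₂ eq = inj₂ (cong (ω^ a ⊕_) eq)

-- raise g b: the least ordinal ≥ g whose last exponent is ≥ b.  This is the
-- downward step of the meet in the Ignatiev algebra.

raise : Tm → Tm → Tm
raise g b with ℓ g <? b
... | yes _ = g +ω^ b
... | no _  = g

raise-≥ : ∀ g b → g ≤ raise g b
raise-≥ g b with ℓ g <? b
... | yes _ = inj₁ (<-+ω^ g b)
... | no _  = inj₂ refl

ℓ-raise : ∀ g b → b ≤ ℓ (raise g b)
ℓ-raise g b with ℓ g <? b
... | yes _    = inj₂ (sym (ℓ-+ω^ g b))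
... | no ℓg≮b = ≮⇒≥ ℓg≮b

raise-nf : ∀ g b → IsNF g → IsNF b → IsNF (raise g b)
raise-nf g b ng nb with ℓ g <? b
... | yes _ = nf-+ω^ g ng nb
... | no _  = ng

raise-least : ∀ g b v → IsNF g → IsNF v → g ≤ v → b ≤ ℓ v → raise g b ≤ v
raise-least g b v ng nv g≤v b≤ℓv with ℓ g <? b
... | yes ℓg<b = +ω^-least g v b ng nv g≤v b≤ℓv ℓg<b
... | no _     = g≤v

_⊔_ : Tm → Tm → Tm
a ⊔ b with a <? b
... | yes _ = b
... | no _  = a

⊔-≥ˡ : ∀ a b → a ≤ a ⊔ b
⊔-≥ˡ a b with a <? b
... | yes a<b = inj₁ a<b
... | no _    = inj₂ refl

⊔-≥ʳ : ∀ a b → b ≤ a ⊔ b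
⊔-≥ʳ a b with a <? b
... | yes _   = inj₂ refl
... | no a≮b = ≮⇒≥ a≮b

⊔-least : ∀ {a b c} → a ≤ c → b ≤ c → a ⊔ b ≤ c
⊔-least {a} {b} a≤c b≤c with a <? b
... | yes _ = b≤c
... | no _  = a≤c

⊔-nf : ∀ {a b} → IsNF a → IsNF b → IsNF (a ⊔ b)
⊔-nf {a} {b} na nb with a <? b
... | yes _ = nb
... | no _  = na

-- The least Ignatiev sequence above a pointwise bound γ that vanishes from
-- position N on.  approx γ k j computes its j-th entry by k downward raise
-- steps; once j + k ≥ N the result no longer depends on k.

approx : (ℕ → Tm) → ℕ → ℕ → Tm
approx γ zero    j = 𝟎
approx γ (suc k) j = raise (γ j) (approx γ k (suc j))

module Closure (γ : ℕ → Tm) (nfγ : ∀ j → IsNF (γ j))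
               (N : ℕ) (γ-vanishes : ∀ j → N ≤ₙ j → γ j ≡ 𝟎) where

  approx-stable : ∀ k j → N ≤ₙ j +ₙ k → approx γ k j ≡ approx γ (suc k) j
  approx-stable zero    j N≤j
    rewrite γ-vanishes j (subst (N ≤ₙ_) (+-identityʳ j) N≤j) = refl
  approx-stable (suc k) j N≤j+k+1 =
    cong (raise (γ j)) (approx-stable k (suc j) (subst (N ≤ₙ_) (+-suc j k) N≤j+k+1))

  approx-nf : ∀ k j → IsNF (approx γ k j)
  approx-nf zero    j = nf𝟎
  approx-nf (suc k) j = raise-nf _ _ (nfγ j) (approx-nf k (suc j))

  approx-least : (v : ISeq) → (∀ j → γ j ≤ seq v j) → ∀ k j → approx γ k j ≤ seq v j
  approx-least v γ≤v zero    j = 𝟎≤ _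
  approx-least v γ≤v (suc k) j = raise-least _ _ _ (nfγ j) (nf v j) (γ≤v j)
    (≤-trans (approx-least v γ≤v k (suc j)) (cond v j))

  δ : ℕ → Tm
  δ = approx γ N

  δ-unfold : ∀ j → δ j ≡ raise (γ j) (δ (suc j))
  δ-unfold j = approx-stable N j (m≤n+m N j)

  δ-cond : ∀ j → δ (suc j) ≤ ℓ (δ j)
  δ-cond j = subst (λ x → δ (suc j) ≤ ℓ x) (sym (δ-unfold j)) (ℓ-raise (γ j) (δ (suc j)))

  γ≤δ : ∀ j → γ j ≤ δ j
  γ≤δ j = subst (γ j ≤_) (sym (δ-unfold j)) (raise-≥ (γ j) (δ (suc j)))

  closure : ISeq
  closure = record { seq = δ ; nf = approx-nf N ; cond = δ-cond }

Vanishes : ℕ → ISeq → Set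
Vanishes N s = ∀ j → N ≤ₙ j → seq s j ≡ 𝟎

vanishes-weaken : ∀ {N s} → Vanishes N s → Vanishes (suc N) s
vanishes-weaken s-vanishes j N+1≤j = s-vanishes j (≤ₙ-trans (n≤1+n _) N+1≤j)

-- Two sequences of finite support have a meet: the closure of their pointwise
-- maximum.
module Meet (s t : ISeq) (N : ℕ) (s-vanishes : Vanishes N s) (t-vanishes : Vanishes N t) where

  upper : ℕ → Tm
  upper j = seq s j ⊔ seq t j

  upper-vanishes : ∀ j → N ≤ₙ j → upper j ≡ 𝟎
  upper-vanishes j N≤j rewrite s-vanishes j N≤j | t-vanishes j N≤j = refl

  open Closure upper (λ j → ⊔-nf (nf s j) (nf t j)) N upper-vanishes

  meet : ISeq
  meet = closure

  meet-isMeet : IsMeet meet s t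
  meet-isMeet = ( (λ j → ≤-trans (⊔-≥ˡ _ _) (γ≤δ j))
                , (λ j → ≤-trans (⊔-≥ʳ (seq s j) _) (γ≤δ j)) )
              , (λ u u≤s u≤t j → approx-least u (λ j → ⊔-least (u≤s j) (u≤t j)) N j)

replaceAt : (ℕ → Tm) → ℕ → Tm → ℕ → Tm
replaceAt s zero    β zero    = β
replaceAt s zero    β (suc j) = 𝟎
replaceAt s (suc i) β zero    = s zero
replaceAt s (suc i) β (suc j) = replaceAt (λ k → s (suc k)) i β j

replaceAt-≤ : ∀ s i β → β ≤ s i → ∀ j → replaceAt s i β j ≤ s j
replaceAt-≤ s zero    β β≤sᵢ zero    = β≤sᵢ
replaceAt-≤ s zero    β β≤sᵢ (suc j) = 𝟎≤ _
replaceAt-≤ s (suc i) β β≤sᵢ zero    = inj₂ refl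
replaceAt-≤ s (suc i) β β≤sᵢ (suc j) = replaceAt-≤ (λ k → s (suc k)) i β β≤sᵢ j

replaceAt-at : ∀ s i β → replaceAt s i β i ≡ β
replaceAt-at s zero    β = refl
replaceAt-at s (suc i) β = replaceAt-at (λ k → s (suc k)) i β

replaceAt-beyond : ∀ s i β j → i <ₙ j → replaceAt s i β j ≡ 𝟎
replaceAt-beyond s zero    β (suc j) _         = refl
replaceAt-beyond s (suc i) β (suc j) (s≤s i<j) = replaceAt-beyond (λ k → s (suc k)) i β j i<j

replaceAt-nf : ∀ s i β → (∀ j → IsNF (s j)) → IsNF β → ∀ j → IsNF (replaceAt s i β j)
replaceAt-nf s zero    β ns nβ zero    = nβ
replaceAt-nf s zero    β ns nβ (suc j) = nf𝟎
replaceAt-nf s (suc i) β ns nβ zero    = ns zero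
replaceAt-nf s (suc i) β ns nβ (suc j) = replaceAt-nf (λ k → s (suc k)) i β (λ k → ns (suc k)) nβ j

replaceAt-cond : ∀ s i β → (∀ j → s (suc j) ≤ ℓ (s j)) → β ≤ s i →
                 ∀ j → replaceAt s i β (suc j) ≤ ℓ (replaceAt s i β j)
replaceAt-cond s zero    β s-cond β≤sᵢ j       = 𝟎≤ _
replaceAt-cond s (suc i) β s-cond β≤sᵢ zero    =
  ≤-trans (replaceAt-≤ (λ k → s (suc k)) i β β≤sᵢ zero) (s-cond zero)
replaceAt-cond s (suc i) β s-cond β≤sᵢ (suc j) =
  replaceAt-cond (λ k → s (suc k)) i β (λ k → s-cond (suc k)) β≤sᵢ j

lowered : (s : ISeq) (i : ℕ) (β : Tm) → IsNF β → β ≤ seq s i → ISeq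
lowered s i β nβ β≤sᵢ = record
  { seq  = replaceAt (seq s) i β
  ; nf   = replaceAt-nf (seq s) i β (nf s) nβ
  ; cond = replaceAt-cond (seq s) i β (cond s) β≤sᵢ }

truncate : ISeq → ℕ → ISeq
truncate s i = lowered s i (seq s i) (nf s i) (inj₂ refl)

truncate-vanishes : ∀ s i → Vanishes (suc i) (truncate s i)
truncate-vanishes s i = replaceAt-beyond (seq s) i (seq s i)

module _ {F : ISeq → Set} (isFilter : IsFilter F) where
  open IsFilter isFilter

  proj-nonempty : ∀ i → ∃ λ α → Proj F i α
  proj-nonempty i with nonempty
  ... | s , s∈F = seq s i , s , s∈F , refl

  lowered∈F : ∀ {s} i β nβ β≤sᵢ → F s → F (lowered s i β nβ β≤sᵢ)
  lowered∈F {s} i β _ β≤sᵢ s∈F = upward s∈F (replaceAt-≤ (seq s) i β β≤sᵢ)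

  proj-downward : ∀ i α β → IsNF β → Proj F i α → β ≤ α → Proj F i β
  proj-downward i _ β nβ (s , s∈F , refl) β≤sᵢ =
    lowered s i β nβ β≤sᵢ , lowered∈F i β nβ β≤sᵢ s∈F , replaceAt-at (seq s) i β

  truncate∈F : ∀ {s} i → F s → F (truncate s i)
  truncate∈F {s} i = lowered∈F i (seq s i) (nf s i) (inj₂ refl)

  proj-sum : ∀ i α β → Proj F i α → Proj F (suc i) β → ℓ α < β → Proj F i (α +ω^ β)
  proj-sum i _ _ (s , s∈F , refl) (t , t∈F , refl) ℓα<β =
    proj-downward i (seq meet i) α+ω^β (nf-+ω^ α (nf s i) (nf t (suc i)))
      (meet , meet∈F , refl) α+ω^β≤mᵢ
    where
    α β α+ω^β : Tm
    α = seq s i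
    β = seq t (suc i)
    α+ω^β = α +ω^ β
    open Meet (truncate s i) (truncate t (suc i)) (suc (suc i))
              (vanishes-weaken {s = truncate s i} (truncate-vanishes s i))
              (truncate-vanishes t (suc i))
    meet∈F : F meet
    meet∈F = meetClosed (truncate∈F i s∈F) (truncate∈F (suc i) t∈F) meet-isMeet
    α≤mᵢ : α ≤ seq meet i
    α≤mᵢ = subst (_≤ seq meet i) (replaceAt-at (seq s) i α) (proj₁ (proj₁ meet-isMeet) i)
    β≤mᵢ₊₁ : β ≤ seq meet (suc i)
    β≤mᵢ₊₁ = subst (_≤ seq meet (suc i)) (replaceAt-at (seq t) (suc i) β)
                   (proj₂ (proj₁ meet-isMeet) (suc i))
    α+ω^β≤mᵢ : α+ω^β ≤ seq meet i
    α+ω^β≤mᵢ = +ω^-least α (seq meet i) β (nf s i) (nf meet i) α≤mᵢ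
                 (≤-trans β≤mᵢ₊₁ (cond meet i)) ℓα<β

mainTheorem2 : (F : ISeq → Set) → IsFilter F → (i : ℕ) →
    (∃ λ α → Proj F i α)
    × (∀ α β → IsNF β → Proj F i α → β < α → Proj F i β)
    × (∀ α β → Proj F i α → Proj F (suc i) β → ℓ α < β → Proj F i (α +ω^ β))
mainTheorem2 F isFilter i =
    proj-nonempty isFilter i
  , (λ α β nβ α∈Fᵢ β<α → proj-downward isFilter i α β nβ α∈Fᵢ (inj₁ β<α))
  , proj-sum isFilter i
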